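{- Let $t$ be a $\lambda\mu$T-term in normal form (with respect to $\to$) such that $\emptyset;\Delta\vdash t:\rho$ for some $\Delta$ and $\rho$. Then $t$ is a value, or $t\equiv\mu\alpha.[\beta]v$ for some $\mu$-variables $\alpha,\beta$ and some value $v$.
   Context: The $\lambda\mu$T-calculus. Types: $\rho,\sigma,\tau ::= \mathbb N \mid \sigma\to\tau$. Over infinite sets of $\lambda$-variables $x,y,\dots$ and $\mu$-variables $\alpha,\beta,\dots$, terms and commands: $t,r,s ::= x \mid \lambda x{:}\rho.r \mid ts \mid \mu\alpha{:}\rho.c \mid 0 \mid \mathsf S\,t \mid \mathsf{nrec}_\rho\ r\ s\ t$, $c ::= [\alpha]t$. $\mathrm{FCV}(t)$: free $\mu$-variables. Numerals $\overline n := \mathsf S^n 0$. Values: $v ::= 0 \mid \mathsf S\,v \mid \lambda x.r$. Typing judgments $\Gamma;\Delta\vdash t:\rho$, $\Gamma;\Delta\vdash c$ generated by: $x:\rho\in\Gamma\Rightarrow\Gamma;\Delta\vdash x:\rho$; $\Gamma,x{:}\sigma;\Delta\vdash t:\tau\Rightarrow\Gamma;\Delta\vdash\lambda x{:}\sigma.t:\sigma\to\tau$; $\Gamma;\Delta\vdash t:\sigma\to\tau$, $\Gamma;\Delta\vdash s:\sigma\Rightarrow\Gamma;\Delta\vdash ts:\tau$; $\Gamma;\Delta\vdash0:\mathbb N$; $\Gamma;\Delta\vdash t:\mathbb N\Rightarrow\Gamma;\Delta\vdash\mathsf S\,t:\mathbb N$; $\Gamma;\Delta\vdash r:\rho$,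 $\Gamma;\Delta\vdash s:\mathbb N\to\rho\to\rho$, $\Gamma;\Delta\vdash t:\mathbb N\Rightarrow\Gamma;\Delta\vdash\mathsf{nrec}_\rho\ r\ s\ t:\rho$; $\Gamma;\Delta,\alpha{:}\rho\vdash c\Rightarrow\Gamma;\Delta\vdash\mu\alpha{:}\rho.c:\rho$; $\Gamma;\Delta\vdash t:\rho$, $\alpha:\rho\in\Delta\Rightarrow\Gamma;\Delta\vdash[\alpha]t$. Contexts $E ::= \Box \mid E\,t \mid \mathsf S\,E \mid \mathsf{nrec}\ r\ s\ E$. Structural substitution $t[\alpha:=\beta E]$ replaces recursively every subcommand $[\alpha]q$ by $[\beta]E[q[\alpha:=\beta E]]$ (capture-avoiding). Reduction $\to$ is the compatible closure (on terms and commands) of: $(\lambda x.t)r \to t[x:=r]$; $\mathsf S(\mu\alpha.c)\to \mu\alpha.c[\alpha:=\alpha(\mathsf S\Box)]$; $(\mu\alpha.c)s\to\mu\alpha.c[\alpha:=\alpha(\Box s)]$; $\mu\alpha.[\alpha]t\to t$ if $\alpha\notin\mathrm{FCV}(t)$; $[\alpha]\mu\beta.c\to c[\beta:=\alpha\,\Box]$; $\mathsf{nrec}\ r\ s\ 0\to r$; $\mathsf{nrec}\ r\ s\ (\mathsf S\,\overline n)\to s\ \overline n\ (\mathsf{nrec}\ r\ s\ \overline n)$; $\mathsf{nrec}\ r\ s\ (\mu\alpha.c)\to\mu\alpha.c[\alpha:=\alpha(\mathsf{nrec}\ r\ s\ \Box)]$. A term is in normal form if no $\to$ step applies to it. -}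

module Defs where

open import Data.Nat using (ℕ; zero; suc)
open import Data.List using (List; []; _∷_)
open import Data.Product using (_×_; _,_; Σ)
open import Data.Maybe using (Maybe; just; nothing)
import Data.Maybe as Maybe
open import Relation.Nullary using (¬_)

-- Variables (both λ-variables and μ-variables) are de Bruijn indices;
-- λ-variables and μ-variables live in two separate index spaces.

data Ty : Set where
  nat : Ty
  _⇒_ : Ty → Ty → Ty

infixr 7 _⇒_

mutual
  data Tm : Set where
    var  : ℕ → Tm
    lam  : Ty → Tm → Tm           -- λx:ρ.r   (binds λ-index 0)
    app  : Tm → Tm → Tm
    mu   : Ty → Cmd → Tm          -- μα:ρ.c   (binds μ-index 0)
    zer  : Tm
    S    : Tm → Tm
    nrec : Ty → Tm → Tm → Tm → Tm

  data Cmd : Set where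
    cmd : ℕ → Tm → Cmd

data Numeral : Tm → Set where
  num0 : Numeral zer
  numS : ∀ {t} → Numeral t → Numeral (S t)

data Value : Tm → Set where
  val0   : Value zer
  valS   : ∀ {v} → Value v → Value (S v)
  vallam : ∀ {ρ r} → Value (lam ρ r)

data _∶_∈_ : ℕ → Ty → List Ty → Set where
  here  : ∀ {ρ Γ} → zero ∶ ρ ∈ (ρ ∷ Γ)
  there : ∀ {n ρ σ Γ} → n ∶ ρ ∈ Γ → suc n ∶ ρ ∈ (σ ∷ Γ)

mutual
  data _︔_⊢_∶_ (Γ Δ : List Ty) : Tm → Ty → Set where
    tvar  : ∀ {x ρ} → x ∶ ρ ∈ Γ → Γ ︔ Δ ⊢ var x ∶ ρ
    tlam  : ∀ {σ τ t} → (σ ∷ Γ) ︔ Δ ⊢ t ∶ τ → Γ ︔ Δ ⊢ lam σ t ∶ (σ ⇒ τ)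
    tapp  : ∀ {σ τ t s} → Γ ︔ Δ ⊢ t ∶ (σ ⇒ τ) → Γ ︔ Δ ⊢ s ∶ σ → Γ ︔ Δ ⊢ app t s ∶ τ
    tzer  : Γ ︔ Δ ⊢ zer ∶ nat
    tS    : ∀ {t} → Γ ︔ Δ ⊢ t ∶ nat → Γ ︔ Δ ⊢ S t ∶ nat
    tnrec : ∀ {ρ r s t} → Γ ︔ Δ ⊢ r ∶ ρ → Γ ︔ Δ ⊢ s ∶ (nat ⇒ ρ ⇒ ρ) → Γ ︔ Δ ⊢ t ∶ nat
          → Γ ︔ Δ ⊢ nrec ρ r s t ∶ ρ
    tmu   : ∀ {ρ c} → Γ ︔ (ρ ∷ Δ) ⊢c c → Γ ︔ Δ ⊢ mu ρ c ∶ ρ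

  data _︔_⊢c_ (Γ Δ : List Ty) : Cmd → Set where
    tcmd : ∀ {α ρ t} → Γ ︔ Δ ⊢ t ∶ ρ → α ∶ ρ ∈ Δ → Γ ︔ Δ ⊢c cmd α t

ext : (ℕ → ℕ) → ℕ → ℕ
ext f zero    = zero
ext f (suc n) = suc (f n)

mutual
  renλ : (ℕ → ℕ) → Tm → Tm
  renλ f (var x)        = var (f x)
  renλ f (lam σ t)      = lam σ (renλ (ext f) t)
  renλ f (app t s)      = app (renλ f t) (renλ f s)
  renλ f (mu ρ c)       = mu ρ (renλc f c)
  renλ f zer            = zer
  renλ f (S t)          = S (renλ f t)
  renλ f (nrec ρ r s t) = nrec ρ (renλ f r) (renλ f s) (renλ f t)

  renλc : (ℕ → ℕ) → Cmd → Cmd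
  renλc f (cmd α t) = cmd α (renλ f t)

mutual
  renμ : (ℕ → ℕ) → Tm → Tm
  renμ f (var x)        = var x
  renμ f (lam σ t)      = lam σ (renμ f t)
  renμ f (app t s)      = app (renμ f t) (renμ f s)
  renμ f (mu ρ c)       = mu ρ (renμc (ext f) c)
  renμ f zer            = zer
  renμ f (S t)          = S (renμ f t)
  renμ f (nrec ρ r s t) = nrec ρ (renμ f r) (renμ f s) (renμ f t)

  renμc : (ℕ → ℕ) → Cmd → Cmd
  renμc f (cmd α t) = cmd (f α) (renμ f t)

exts : (ℕ → Tm) → ℕ → Tm
exts σ zero    = var zero
exts σ (suc n) = renλ suc (σ n)

mutual
  sub : (ℕ → Tm) → Tm → Tm
  sub σ (var x)        = σ x
  sub σ (lam ρ t)      = lam ρ (sub (exts σ) t)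
  sub σ (app t s)      = app (sub σ t) (sub σ s)
  sub σ (mu ρ c)       = mu ρ (subc (λ n → renμ suc (σ n)) c)
  sub σ zer            = zer
  sub σ (S t)          = S (sub σ t)
  sub σ (nrec ρ r s t) = nrec ρ (sub σ r) (sub σ s) (sub σ t)

  subc : (ℕ → Tm) → Cmd → Cmd
  subc σ (cmd α t) = cmd α (sub σ t)

subst0 : Tm → Tm → Tm
subst0 t r = sub σ t
  where
  σ : ℕ → Tm
  σ zero    = r
  σ (suc n) = var n

data Ctx : Set where
  hole  : Ctx
  appE  : Ctx → Tm → Ctx
  SE    : Ctx → Ctx
  nrecE : Ty → Tm → Tm → Ctx → Ctx

plug : Ctx → Tm → Tm
plug hole           q = q
plug (appE E t)     q = app (plug E q) t
plug (SE E)         q = S (plug E q)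
plug (nrecE ρ r s E) q = nrec ρ r s (plug E q)

renλE : (ℕ → ℕ) → Ctx → Ctx
renλE f hole            = hole
renλE f (appE E t)      = appE (renλE f E) (renλ f t)
renλE f (SE E)          = SE (renλE f E)
renλE f (nrecE ρ r s E) = nrecE ρ (renλ f r) (renλ f s) (renλE f E)

renμE : (ℕ → ℕ) → Ctx → Ctx
renμE f hole            = hole
renμE f (appE E t)      = appE (renμE f E) (renμ f t)
renμE f (SE E)          = SE (renμE f E)
renμE f (nrecE ρ r s E) = nrecE ρ (renμ f r) (renμ f s) (renμE f E)

-- A structural substitution θ assigns to every μ-variable α a target
-- (β , just E)  meaning  [α]q ↦ [β] E[q θ],   or
-- (β , nothing) meaning  [α]q ↦ [β] (q θ)   (i.e. E = □, a renaming).

STarget : Set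
STarget = ℕ × Maybe Ctx

liftμθ : (ℕ → STarget) → ℕ → STarget
liftμθ θ zero    = (zero , nothing)
liftμθ θ (suc n) with θ n
... | (β , mE) = (suc β , Maybe.map (renμE suc) mE)

liftλθ : (ℕ → STarget) → ℕ → STarget
liftλθ θ n with θ n
... | (β , mE) = (β , Maybe.map (renλE suc) mE)

fill : STarget → Tm → Cmd
fill (β , nothing) q = cmd β q
fill (β , just E)  q = cmd β (plug E q)

mutual
  ssub : (ℕ → STarget) → Tm → Tm
  ssub θ (var x)        = var x
  ssub θ (lam σ t)      = lam σ (ssub (liftλθ θ) t)
  ssub θ (app t s)      = app (ssub θ t) (ssub θ s)
  ssub θ (mu ρ c)       = mu ρ (ssubc (liftμθ θ) c)
  ssub θ zer            = zer
  ssub θ (S t)          = S (ssub θ t)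
  ssub θ (nrec ρ r s t) = nrec ρ (ssub θ r) (ssub θ s) (ssub θ t)

  ssubc : (ℕ → STarget) → Cmd → Cmd
  ssubc θ (cmd α q) = fill (θ α) (ssub θ q)

-- c [ α := α E ]  where α is the μ-variable bound by the enclosing μ
-- (index 0) and E lives in the scope inside that μ-binder.
self : Ctx → ℕ → STarget
self E zero    = (zero , just E)
self E (suc n) = (suc n , nothing)

-- c [ β := α □ ]  where β (index 0) is removed and α is a variable of
-- the outer scope.
redirect : ℕ → ℕ → STarget
redirect α zero    = (α , nothing)
redirect α (suc n) = (n , nothing)

mutual
  data _⟶_ : Tm → Tm → Set where
    βλ     : ∀ {σ t r} → app (lam σ t) r ⟶ subst0 t r
    μS     : ∀ {ρ c} → S (mu ρ c) ⟶ mu ρ (ssubc (self (SE hole)) c)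
    μapp   : ∀ {σ τ c s} → app (mu (σ ⇒ τ) c) s
                         ⟶ mu τ (ssubc (self (appE hole (renμ suc s))) c)
    -- μα.[α]t → t if α ∉ FCV(t): t is then the weakening of a term t'
    μη     : ∀ {ρ t} → mu ρ (cmd zero (renμ suc t)) ⟶ t
    nrec0  : ∀ {ρ r s} → nrec ρ r s zer ⟶ r
    nrecS  : ∀ {ρ r s n} → Numeral n → nrec ρ r s (S n) ⟶ app (app s n) (nrec ρ r s n)
    nrecμ  : ∀ {ρ σ r s c} → nrec ρ r s (mu σ c)
                           ⟶ mu ρ (ssubc (self (nrecE ρ (renμ suc r) (renμ suc s) hole)) c)
    ξlam   : ∀ {σ t t'} → t ⟶ t' → lam σ t ⟶ lam σ t'
    ξappl  : ∀ {t t' s} → t ⟶ t' → app t s ⟶ app t' s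
    ξappr  : ∀ {t s s'} → s ⟶ s' → app t s ⟶ app t s'
    ξmu    : ∀ {ρ c c'} → c ⟶c c' → mu ρ c ⟶ mu ρ c'
    ξS     : ∀ {t t'} → t ⟶ t' → S t ⟶ S t'
    ξnrec1 : ∀ {ρ r r' s t} → r ⟶ r' → nrec ρ r s t ⟶ nrec ρ r' s t
    ξnrec2 : ∀ {ρ r s s' t} → s ⟶ s' → nrec ρ r s t ⟶ nrec ρ r s' t
    ξnrec3 : ∀ {ρ r s t t'} → t ⟶ t' → nrec ρ r s t ⟶ nrec ρ r s t'

  data _⟶c_ : Cmd → Cmd → Set where
    μμ     : ∀ {α ρ c} → cmd α (mu ρ c) ⟶c ssubc (redirect α) c
    ξcmd   : ∀ {α t t'} → t ⟶ t' → cmd α t ⟶c cmd α t'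

NormalForm : Tm → Set
NormalForm t = ∀ t' → ¬ (t ⟶ t')

module Submission where

-- Call a term *canonical* if it is a value v or a named value μα.[β]v.
-- We show by induction on the typing derivation that every closed, typed
-- term in normal form is canonical.  The argument has three ingredients:
--   * normality is inherited by the subterms in evaluation position
--     (the function of an application, the argument of S and of nrec,
--     the body of a μ-command), so the induction hypothesis applies there;
--   * canonical forms: a value of arrow type is a λ-abstraction, and a
--     value of type ℕ is a numeral;
--   * every eliminator applied to a canonical term of the right type is a
--     redex (β, μapp, nrec0/nrecS, nrecμ, μS, μμ), contradicting normality.
-- Closedness is needed only to rule out variables.

open import Defs
open import Data.List using (List; [])
open import Data.Nat using (ℕ)
open import Data.Product using (Σ; _×_; _,_)
open import Data.Sum using (_⊎_; inj₁; inj₂)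
open import Data.Empty using (⊥; ⊥-elim)
open import Relation.Binary.PropositionalEquality using (_≡_; refl)

data Canonical : Tm → Set where
  value : ∀ {v} → Value v → Canonical v
  named : ∀ {σ β v} → Value v → Canonical (mu σ (cmd β v))

canonical-disjunction : ∀ {t} → Canonical t
  → Value t ⊎ Σ Ty (λ σ → Σ ℕ (λ β → Σ Tm (λ v → Value v × t ≡ mu σ (cmd β v))))
canonical-disjunction (value v)                    = inj₁ v
canonical-disjunction (named {σ} {β} {v} isValue) = inj₂ (σ , β , v , isValue , refl)

Reducible : Tm → Set
Reducible t = Σ Tm (λ t' → t ⟶ t')

normal-irreducible : ∀ {t} → NormalForm t → Reducible t → ⊥
normal-irreducible nf (t' , step) = nf t' step

normal-appˡ : ∀ {t s} → NormalForm (app t s) → NormalForm t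
normal-appˡ nf t' step = nf _ (ξappl step)

normal-S : ∀ {t} → NormalForm (S t) → NormalForm t
normal-S nf t' step = nf _ (ξS step)

normal-nrec : ∀ {ρ r s t} → NormalForm (nrec ρ r s t) → NormalForm t
normal-nrec nf t' step = nf _ (ξnrec3 step)

normal-mu : ∀ {ρ α t} → NormalForm (mu ρ (cmd α t)) → NormalForm t
normal-mu nf t' step = nf _ (ξmu (ξcmd step))

nat-value-numeral : ∀ {Γ Δ v} → Value v → Γ ︔ Δ ⊢ v ∶ nat → Numeral v
nat-value-numeral val0     tzer   = num0
nat-value-numeral (valS v) (tS d) = numS (nat-value-numeral v d)

app-reducible : ∀ {Γ Δ σ τ t} s → Canonical t → Γ ︔ Δ ⊢ t ∶ (σ ⇒ τ)
  → Reducible (app t s)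
app-reducible s (value vallam) _        = _ , βλ
app-reducible s (named _)      (tmu _)  = _ , μapp

nrec-reducible : ∀ {Γ Δ ρ r s t} → Canonical t → Γ ︔ Δ ⊢ t ∶ nat
  → Reducible (nrec ρ r s t)
nrec-reducible (value v) d with nat-value-numeral v d
... | num0   = _ , nrec0
... | numS n = _ , nrecS n
nrec-reducible (named _) _ = _ , nrecμ

normal-canonical : ∀ {Δ ρ t} → NormalForm t → [] ︔ Δ ⊢ t ∶ ρ → Canonical t
normal-canonical nf (tvar ())
normal-canonical nf (tlam _) = value vallam
normal-canonical nf tzer     = value val0
normal-canonical nf (tapp {s = s} d _) =
  ⊥-elim (normal-irreducible nf
    (app-reducible s (normal-canonical (normal-appˡ nf) d) d))
normal-canonical nf (tnrec _ _ d) =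
  ⊥-elim (normal-irreducible nf
    (nrec-reducible (normal-canonical (normal-nrec nf) d) d))
normal-canonical nf (tS d) with normal-canonical (normal-S nf) d
... | value v = value (valS v)
... | named _ = ⊥-elim (normal-irreducible nf (_ , μS))
normal-canonical nf (tmu (tcmd d _)) with normal-canonical (normal-mu nf) d
... | value v = named v
... | named _ = ⊥-elim (normal-irreducible nf (_ , ξmu μμ))

lemma3p23 : ∀ {Δ : List Ty} {ρ : Ty} (t : Tm)
    → NormalForm t
    → [] ︔ Δ ⊢ t ∶ ρ
    → Value t ⊎ Σ Ty (λ σ → Σ ℕ (λ β → Σ Tm (λ v → Value v × t ≡ mu σ (cmd β v))))
lemma3p23 t nf d = canonical-disjunction (normal-canonical nf d)
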